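{- Let $n\ge1$ be an integer with $10\nmid n$ and $n\neq r(n)$, and let $k,j\ge1$ be integers such that $n(kj)$ is a $v$-palindrome. Then the type of $n(kj)$ with respect to $n$ equals the type of $n(kj)$ with respect to $n(k)$, i.e. \[ \mathbf{Type}(n(kj),n)=\mathbf{Type}(n(kj),n(k)). \] (Here $n(kj)=(n(k))(j)$, and $n(k)$ again satisfies $10\nmid n(k)$ and $n(k)\ne r(n(k))$, so both types are defined.)
   Context: Notation. $\mathbb{N}=\{1,2,3,\dots\}$. For a prime $p$ and integer $x\ne0$, $\operatorname{ord}_p(x)$ is the largest $a$ with $p^a\mid x$; $\operatorname{sgn}(x)=1$ if $x>0$ and $-1$ if $x<0$. If $n=\sum_{i=0}^{L-1}d_i10^i$ with digits $0\le d_i<10$, $d_{L-1}\ne0$, then $n$ has $L$ digits and $r(n)=\sum_{i=0}^{L-1}d_{L-1-i}10^i$. If $n=p_1^{a_1}\cdots p_s^{a_s}q_1\cdots q_t$ with distinct primes and $a_i\ge2$, then $v(n)=\sum_i(p_i+a_i)+\sum_j q_j$. An integer $n\ge1$ is a $v$-palindrome if $10\nmid n$, $n\ne r(n)$ and $v(n)=v(r(n))$. For $k,L\ge1$, $\rho_{k,L}=\sum_{i=0}^{k-1}10^{iL}$, and if $n$ has $L$ digits, $n(k)=n\rho_{k,L}$ (the digits of $n$ written $k$ times in a row). For $p\notin\{2,5\}$ prime, $\alpha\ge1$, $L\ge1$, $h_{p^\alpha,L}$ is the multiplicative order of $10^L$ modulo $p^{\alpha+\operatorname{ord}_p(10^L-1)}$.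 For finite $A,B\subseteq\mathbb{N}$, $S(A,B)=\{x\in\mathbb{Z}: a\mid x\ \forall a\in A,\ b\nmid x\ \forall b\in B\}$. Functions $\varphi_{p,\delta}:\mathbb{N}\cup\{0\}\to\mathbb{N}$ ($p$ prime, $\delta\ge1$): $\varphi_{2,1}(\alpha)=2$ if $\alpha\in\{0,1\}$, $=1$ if $\alpha\ge2$; for $p\ne2$, $\varphi_{p,1}(\alpha)=p,2,1$ according as $\alpha=0$, $\alpha=1$, $\alpha\ge2$; for $\delta\ge2$, $\varphi_{p,\delta}(\alpha)=p+\delta,\,1+\delta,\,\delta$ according as $\alpha=0$, $\alpha=1$, $\alpha\ge2$. Put $R_{p,\delta}=\varphi_{p,\delta}(\mathbb{N}\cup\{0\})$. For $p$ prime, $\delta\ge1$, $u\in R_{p,\delta}$, $\mu\ge0$, define the case $D(p,\delta,u,\mu)$ as: [i] if ($\varphi_{p,\delta}^{ -1}(u)=\{0\}$ and $\mu=0$) or ($\varphi_{p,\delta}^{ -1}(u)=\{1\}$ and $\mu=1$) or ($\varphi_{p,\delta}^{ -1}(u)=\{0,1\}$ and $\mu=1$); [ii] if $\varphi_{p,\delta}^{ -1}(u)=\{1\}$, $\mu=0$; [iii] if $\varphi_{p,\delta}^{ -1}(u)=\{0,1\}$, $\mu=0$; [iv] if $\varphi_{p,\delta}^{ -1}(u)=\{2,3,\dots\}$, $\mu=1$; [v] if $\varphi_{p,\delta}^{ -1}(u)=\{2,3,\dots\}$, $\mu=0$; [vi] if $\varphi_{p,\delta}^{ -1}(u)=\{2,3,\dots\}$,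 $\mu\ge2$; [vii] otherwise. Procedure and type. Let $N\ge1$ with $10\nmid N$, $N\ne r(N)$, having $L$ digits. The crucial primes of $N$ are the primes $p_1<\dots<p_m$ with $a_i:=\operatorname{ord}_{p_i}(N)\ne b_i:=\operatorname{ord}_{p_i}(r(N))$; put $\delta_i=a_i-b_i$, $\mu_i=\min(a_i,b_i)$. The characteristic solutions of $N$ are the tuples $\mathbf{u}=(u_1,\dots,u_m)$ with $u_i\in R_{p_i,|\delta_i|}$ and $\sum_i\operatorname{sgn}(\delta_i)u_i=0$. For such $\mathbf{u}$ and each $i$, with $D=D(p_i,|\delta_i|,u_i,\mu_i)$ and $h_{q}:=h_{q,L}$, define $(A_{p_i,\mathbf{u}},B_{p_i,\mathbf{u}})$: if $p_i\notin\{2,5\}$: $(\varnothing,\{h_{p_i}\})$ for [i], $(\{h_{p_i}\},\{h_{p_i^2}\})$ for [ii], $(\varnothing,\{h_{p_i^2}\})$ for [iii], $(\{h_{p_i}\},\varnothing)$ for [iv], $(\{h_{p_i^2}\},\varnothing)$ for [v]; if $p_i\in\{2,5\}$: $(\varnothing,\varnothing)$ for [i] and [iii], $(\varnothing,\{1\})$ for [ii], [iv], [v]; for any $p_i$: $(\varnothing,\varnothing)$ for [vi] and $(\varnothing,\{1\})$ for [vii]. Let $S_{\mathbf{u}}(N)=S\big(\bigcup_iA_{p_i,\mathbf{u}},\bigcup_iB_{p_i,\mathbf{u}}\big)$. It is known (from earlier work) that the sets $S_{\mathbf{u}}(N)$ over the characteristic solutions $\mathbf{u}$ are pairwise disjoint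 and that for $k\ge1$, $N(k)$ is a $v$-palindrome iff $k$ lies in their union. When $N(k)$ is a $v$-palindrome, its type with respect to $N$, $\mathbf{Type}(N(k),N)$, is the unique characteristic solution $\mathbf{u}$ of $N$ with $k\in S_{\mathbf{u}}(N)$. (The crucial primes, the $\delta_i$, and hence the characteristic solutions of $n(k)$ coincide with those of $n$, so the two types are comparable.) -}

module Defs where

open import Data.Bool using (Bool; true; false; if_then_else_; _∧_; _∨_; not)
open import Data.Nat using (ℕ; zero; suc; _+_; _*_; _∸_; _^_; _≤_; _<_; _≡ᵇ_; _<ᵇ_)
open import Data.Nat.DivMod using (_/_; _%_)
open import Data.Nat.Divisibility using (_∣_; _∣?_)
open import Data.Nat.Primality using (Prime; prime?)
open import Data.Integer as ℤ using (ℤ; +_; -_)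
open import Data.Nat.ListAction using (sum)
open import Data.List using (List; []; _∷_; length; map; zip; concatMap; upTo; filterᵇ; foldl; reverse)
open import Data.List.Relation.Unary.All using (All)
open import Data.Product using (Σ; _×_; _,_; proj₁; proj₂)
open import Relation.Nullary using (¬_; Dec)
open import Relation.Nullary.Decidable using (isYes)
open import Relation.Binary.PropositionalEquality using (_≡_; _≢_)

-- little-endian digits d_0, d_1, ..., d_{L-1} (fuel = n suffices)
digitsFuel : ℕ → ℕ → List ℕ
digitsFuel zero    _ = []
digitsFuel (suc f) n = if n ≡ᵇ 0 then [] else (n % 10) ∷ digitsFuel f (n / 10)

digits : ℕ → List ℕ
digits n = digitsFuel n n

len : ℕ → ℕ
len n = length (digits n)

rev : ℕ → ℕ
rev n = foldl (λ acc d → acc * 10 + d) 0 (digits n)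

ρ : ℕ → ℕ → ℕ
ρ k L = sum (map (λ i → 10 ^ (i * L)) (upTo k))

rep : ℕ → ℕ → ℕ
rep n k = n * ρ k (len n)

-- p-adic valuation ord_p(x) (for p ≥ 2, x ≥ 1; fuel = x suffices)

ord : ℕ → ℕ → ℕ
ord zero _ = 0
ord (suc zero) _ = 0
ord p@(suc (suc q)) x = go x x
  where
  go : ℕ → ℕ → ℕ
  go zero    _ = 0
  go (suc f) y = if (not (y ≡ᵇ 0)) ∧ (y % p ≡ᵇ 0) then suc (go f (y / p)) else 0

isPrimeᵇ : ℕ → Bool
isPrimeᵇ p = isYes (prime? p)

primeDivisors : ℕ → List ℕ
primeDivisors n = filterᵇ (λ p → isPrimeᵇ p ∧ isYes (p ∣? n)) (upTo (suc n))

vfun : ℕ → ℕ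
vfun n = sum (map (λ p → if 2 ≤ᵇ' ord p n then p + ord p n else p) (primeDivisors n))
  where
  _≤ᵇ'_ : ℕ → ℕ → Bool
  a ≤ᵇ' b = a <ᵇ suc b

VPal : ℕ → Set
VPal n = (1 ≤ n) × (¬ (10 ∣ n)) × (n ≢ rev n) × (vfun n ≡ vfun (rev n))

-- least t ∈ {1,…,m} with x^t ≡ 1 (mod m)  (exists whenever gcd(x,m)=1, m ≥ 2)
multOrder : ℕ → ℕ → ℕ
multOrder x zero = 0
multOrder x m@(suc m') = go (upTo m)
  where
  go : List ℕ → ℕ
  go [] = 0
  go (t ∷ ts) = if (x ^ suc t) % m ≡ᵇ 1 % m then suc t else go ts

h : ℕ → ℕ → ℕ → ℕ
h p α L = multOrder (10 ^ L) (p ^ (α + ord p (10 ^ L ∸ 1)))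

φ : ℕ → ℕ → ℕ → ℕ
φ p (suc zero) α with p ≡ᵇ 2
... | true  = if α <ᵇ 2 then 2 else 1
... | false = case0 α
  where
  case0 : ℕ → ℕ
  case0 zero = p
  case0 (suc zero) = 2
  case0 (suc (suc _)) = 1
φ p δ zero = p + δ
φ p δ (suc zero) = 1 + δ
φ p δ (suc (suc _)) = δ

InR : ℕ → ℕ → ℕ → Set
InR p δ u = Σ ℕ (λ α → φ p δ α ≡ u)

data Case : Set where
  cI cII cIII cIV cV cVI cVII : Case

-- φ_{p,δ} is constant on {2,3,…}, so φ^{-1}(u) is determined by whether
-- 0, 1, 2 lie in it; "φ^{-1}(u) = {2,3,…}" means 2 ∈, 0 ∉, 1 ∉.
D : ℕ → ℕ → ℕ → ℕ → Case
D p δ u μ = pick (φ p δ 0 ≡ᵇ u) (φ p δ 1 ≡ᵇ u) (φ p δ 2 ≡ᵇ u) μ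
  where
  pick : Bool → Bool → Bool → ℕ → Case
  pick true  false false zero          = cI
  pick false true  false (suc zero)    = cI
  pick true  true  false (suc zero)    = cI
  pick false true  false zero          = cII
  pick true  true  false zero          = cIII
  pick false false true  (suc zero)    = cIV
  pick false false true  zero          = cV
  pick false false true  (suc (suc _)) = cVI
  pick _     _     _     _             = cVII

-- crucial primes of N (in increasing order): primes p with ord_p(N) ≠ ord_p(r(N));
-- such p divide N or r(N), hence p ≤ N * r(N) for N ≥ 1.
crucial : ℕ → List ℕ
crucial N = filterᵇ (λ p → isPrimeᵇ p ∧ not (ord p N ≡ᵇ ord p (rev N)))
                    (upTo (suc (N * rev N)))

absδ : ℕ → ℕ → ℕ
absδ a b = (a ∸ b) + (b ∸ a)

sgnMul : ℕ → ℕ → ℕ → ℤ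
sgnMul a b u = if b <ᵇ a then + u else - (+ u)

sumℤ : List ℤ → ℤ
sumℤ [] = + 0
sumℤ (x ∷ xs) = x ℤ.+ sumℤ xs

-- u is a characteristic solution of N (u listed along the crucial primes p_1<…<p_m)
CharSol : ℕ → List ℕ → Set
CharSol N u =
  (length u ≡ length (crucial N)) ×
  All (λ pu → InR (proj₁ pu) (absδ (ord (proj₁ pu) N) (ord (proj₁ pu) (rev N))) (proj₂ pu))
      (zip (crucial N) u) ×
  (sumℤ (map (λ pu → sgnMul (ord (proj₁ pu) N) (ord (proj₁ pu) (rev N)) (proj₂ pu))
              (zip (crucial N) u)) ≡ + 0)

AB : ℕ → ℕ → ℕ → List ℕ × List ℕ
AB N p up = sel ((p ≡ᵇ 2) ∨ (p ≡ᵇ 5))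
               (D p (absδ a b) up (minℕ a b))
  where
  a = ord p N
  b = ord p (rev N)
  L = len N
  minℕ : ℕ → ℕ → ℕ
  minℕ x y = x ∸ (x ∸ y)
  sel : Bool → Case → List ℕ × List ℕ
  sel false cI   = [] , (h p 1 L ∷ [])
  sel false cII  = (h p 1 L ∷ []) , (h p 2 L ∷ [])
  sel false cIII = [] , (h p 2 L ∷ [])
  sel false cIV  = (h p 1 L ∷ []) , []
  sel false cV   = (h p 2 L ∷ []) , []
  sel true  cI   = [] , []
  sel true  cIII = [] , []
  sel true  cII  = [] , (1 ∷ [])
  sel true  cIV  = [] , (1 ∷ [])
  sel true  cV   = [] , (1 ∷ [])
  sel _     cVI  = [] , []
  sel _     cVII = [] , (1 ∷ [])

Aset : ℕ → List ℕ → List ℕ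
Aset N u = concatMap (λ pu → proj₁ (AB N (proj₁ pu) (proj₂ pu))) (zip (crucial N) u)

Bset : ℕ → List ℕ → List ℕ
Bset N u = concatMap (λ pu → proj₂ (AB N (proj₁ pu) (proj₂ pu))) (zip (crucial N) u)

InS : List ℕ → List ℕ → ℕ → Set
InS A B x = All (λ a → a ∣ x) A × All (λ b → ¬ (b ∣ x)) B

InSu : ℕ → List ℕ → ℕ → Set
InSu N u k = InS (Aset N u) (Bset N u) k

-- u = Type(N(k), N): u is a characteristic solution of N and k ∈ S_u(N)
-- (by the known result, when N(k) is a v-palindrome there is exactly one such u)
IsType : ℕ → ℕ → List ℕ → Set
IsType N k u = CharSol N u × InSu N u k

{-# OPTIONS --safe #-}
-- Write t_p = ord_p ρ_{K,L}. Since N(K) = N ρ_{K,L} and r(N(K)) = r(N) ρ_{K,L}, the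
-- valuations of N(K) and r(N(K)) are a_p + t_p and b_p + t_p. For p ∤ 10 the identity
-- 10^{LK} - 1 = ρ_{K,L} (10^L - 1) gives h_{p^α,L} ∣ K ⇔ α ≤ t_p, and t_2 = t_5 = 0
-- because ρ_{K,L} ≡ 1 (mod 10). So K ∈ S(A_p, B_p) pins t_p down exactly as far as the
-- case D(p, |δ_p|, u_p, μ_p) needs, and in every case forces u_p = φ_{p,|δ_p|}(μ_p + t_p):
-- the type is given coordinatewise by an explicit formula. Replacing n by n(k) adds
-- ord_p ρ_{k,L} to a_p and b_p, which keeps the crucial primes and δ_p and shifts μ_p;
-- as ρ_{kj,L} = ρ_{k,L} ρ_{j,kL}, both formulas give φ_{p,|δ_p|}(μ_p + ord_p ρ_{kj,L}).
module Submission where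

open import Defs
open import Data.Nat using (ℕ; _*_; _≤_)
open import Data.Nat.Divisibility using (_∣_)
open import Data.List using (List)
open import Relation.Nullary using (¬_)
open import Relation.Binary.PropositionalEquality using (_≡_; _≢_)
open import Level using (0ℓ)
open import Data.Bool using (Bool; true; false; if_then_else_; _∧_; _∨_; not; T)
open import Data.Bool.Properties using (T-≡; T-∧; ∧-zeroʳ)
open import Data.Empty using (⊥)
open import Data.Unit using (⊤; tt)
open import Data.Nat
open import Data.Nat.Properties
open import Data.Nat.DivMod
open import Data.Nat.Divisibility
open import Data.Nat.Induction using (<-rec)
open import Data.Nat.ListAction using (sum)
open import Data.Nat.Primality using (Prime; prime?; euclidsLemma; ¬prime[1]; prime[2]; prime⇒irreducible)
open import Data.Nat.Tactic.RingSolver using (solve-∀)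
open import Data.Fin using (Fin; toℕ; fromℕ<)
open import Data.Fin.Properties using (pigeonhole; toℕ-fromℕ<; toℕ<n)
open import Data.List using (List; []; _∷_; _++_; _∷ʳ_; length; map; zip; foldl; filterᵇ; upTo; applyUpTo)
open import Data.List.Properties using (length-++; foldl-++; upTo-∷ʳ; ++-identityʳ; map-cong-local; filter-++; filter-≐; filter-reject)
open import Data.List.Relation.Unary.All as All using (All; []; _∷_; head)
open import Data.List.Relation.Unary.All.Properties using (all-filter; concat⁻; map⁻)
open import Data.Product using (Σ; ∃; ∃₂; _×_; _,_; proj₁; proj₂)
open import Data.Sum using (_⊎_; inj₁; inj₂; [_,_]′)
open import Function using (_∘_; _∘′_)
open import Function.Bundles using (_⇔_; mk⇔; Equivalence)
open import Function.Properties.Equivalence using (⇔-setoid)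
open import Relation.Nullary using (¬_; yes; no; contradiction)
open import Relation.Unary using (_≐_)
open import Relation.Nullary.Decidable using (toWitness; from-yes; T?)
open import Relation.Binary.PropositionalEquality

≡ᵇ-true⇒≡ : ∀ {m n} → (m ≡ᵇ n) ≡ true → m ≡ n
≡ᵇ-true⇒≡ {m} {n} e = ≡ᵇ⇒≡ m n (subst T (sym e) tt)

≡⇒≡ᵇ-true : ∀ {m n} → m ≡ n → (m ≡ᵇ n) ≡ true
≡⇒≡ᵇ-true {m} {n} e = Equivalence.to T-≡ (≡⇒≡ᵇ m n e)

[1+y]/[2+q]≤f : ∀ q {y f} → suc y ≤ suc f → suc y / 2+ q ≤ f
[1+y]/[2+q]≤f q {y} (s≤s y≤f) = ≤-trans (≤-pred (m/n<m (suc y) (2+ q) (s≤s (s≤s z≤n)))) y≤f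

∤⇒nonZero : ∀ {p z} → ¬ p ∣ z → NonZero z
∤⇒nonZero {p} {zero}  p∤0 = contradiction (p ∣0) p∤0
∤⇒nonZero {p} {suc z} _   = _

-- p-adic valuations

ordLoop : ℕ → ℕ → ℕ → ℕ
ordLoop q zero    _ = 0
ordLoop q (suc f) y = if not (y ≡ᵇ 0) ∧ (y % 2+ q ≡ᵇ 0) then suc (ordLoop q f (y / 2+ q)) else 0

ordLoop-unique : ∀ q (G : ℕ → ℕ → ℕ) → (∀ y → G 0 y ≡ 0) →
  (∀ f y → G (suc f) y ≡ (if not (y ≡ᵇ 0) ∧ (y % 2+ q ≡ᵇ 0) then suc (G f (y / 2+ q)) else 0)) →
  ∀ f y → G f y ≡ ordLoop q f y
ordLoop-unique q G G0 Gs zero    y = G0 y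
ordLoop-unique q G G0 Gs (suc f) y
  rewrite Gs f y | ordLoop-unique q G G0 Gs f (y / 2+ q) = refl

-- The loop inside `ord` is where-bound and cannot be named; `loop` captures it as
-- the solution of the metavariable `_`, which unification fixes from its use in `unfold`.
ord≡ordLoop : ∀ q x → ord (2+ q) x ≡ ordLoop q x x
ord≡ordLoop = unfold
  where
  loop : Σ (ℕ → ℕ → ℕ → ℕ → ℕ) λ G → ∀ q x f y → G q x f y ≡ ordLoop q f y
  loop = _ , λ q x → ordLoop-unique q _ (λ _ → refl) (λ _ _ → refl)
  unfold : ∀ q x → ord (2+ q) x ≡ ordLoop q x x
  unfold q zero = refl
  unfold q (suc w) with suc w / 2+ q
  ... | y with suc w
  ... | x = cong (λ r → if suc w % 2+ q ≡ᵇ 0 then suc r else 0) (proj₂ loop q x w y)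

ordLoop-fuel : ∀ q {f f' y} → y ≤ f → y ≤ f' → ordLoop q f y ≡ ordLoop q f' y
ordLoop-fuel q {zero}  {zero}   z≤n _   = refl
ordLoop-fuel q {zero}  {suc f'} z≤n _   = refl
ordLoop-fuel q {suc f} {zero}   _   z≤n = refl
ordLoop-fuel q {suc f} {suc f'} {zero} _ _ = refl
ordLoop-fuel q {suc f} {suc f'} {suc y} y≤f y≤f' with suc y % 2+ q ≡ᵇ 0
... | false = refl
... | true  = cong suc (ordLoop-fuel q ([1+y]/[2+q]≤f q y≤f) ([1+y]/[2+q]≤f q y≤f'))

ord≈ordLoop : ∀ q {f y} → y ≤ f → ord (2+ q) y ≡ ordLoop q f y
ord≈ordLoop q {y = y} y≤f = trans (ord≡ordLoop q y) (ordLoop-fuel q ≤-refl y≤f)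

ordLoop-step : ∀ q f {y} → 2+ q ∣ y → 1 ≤ y → ordLoop q (suc f) y ≡ suc (ordLoop q f (y / 2+ q))
ordLoop-step q f {suc w} P∣y _ with suc w % 2+ q ≡ᵇ 0 in e
... | true  = refl
... | false = contradiction (trans (sym e) (cong (_≡ᵇ 0) (n∣m⇒m%n≡0 (suc w) (2+ q) P∣y))) λ ()

∤⇒ord≡0 : ∀ p {y} → ¬ p ∣ y → ord p y ≡ 0
∤⇒ord≡0 0      _ = refl
∤⇒ord≡0 1      _ = refl
∤⇒ord≡0 (2+ q) {zero}  p∤y = contradiction (2+ q ∣0) p∤y
∤⇒ord≡0 (2+ q) {suc y} p∤y with suc y % 2+ q ≡ᵇ 0 in e
... | false = refl
... | true  = contradiction (m%n≡0⇒n∣m (suc y) (2+ q) (≡ᵇ-true⇒≡ e)) p∤y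

ord-p* : ∀ q {y} → 1 ≤ y → ord (2+ q) (2+ q * y) ≡ suc (ord (2+ q) y)
ord-p* q {y} 1≤y = begin
  ord P (P * y)                         ≡⟨ ord≈ordLoop q (n≤1+n (P * y)) ⟩
  ordLoop q (suc (P * y)) (P * y)       ≡⟨ ordLoop-step q (P * y) (m∣m*n y) 1≤P*y ⟩
  suc (ordLoop q (P * y) (P * y / P))   ≡⟨ cong (λ z → suc (ordLoop q (P * y) z)) (m*n/m≡n P y) ⟩
  suc (ordLoop q (P * y) y)             ≡⟨ cong suc (ord≈ordLoop q (m≤n*m y P)) ⟨
  suc (ord P y)                         ∎
  where
  open ≡-Reasoning
  P = 2+ q
  1≤P*y : 1 ≤ P * y
  1≤P*y = *-mono-≤ {1} {P} (s≤s z≤n) 1≤y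
  m*n/m≡n : ∀ m n .{{_ : NonZero m}} → m * n / m ≡ n
  m*n/m≡n m n = trans (cong (_/ m) (*-comm m n)) (m*n/n≡m n m)

ord-p^* : ∀ q m {z} → ¬ 2+ q ∣ z → ord (2+ q) (2+ q ^ m * z) ≡ m
ord-p^* q zero    {z} P∤z = trans (cong (ord (2+ q)) (*-identityˡ z)) (∤⇒ord≡0 (2+ q) P∤z)
ord-p^* q (suc m) {z} P∤z = begin
  ord (2+ q) (2+ q * 2+ q ^ m * z)    ≡⟨ cong (ord (2+ q)) (*-assoc (2+ q) (2+ q ^ m) z) ⟩
  ord (2+ q) (2+ q * (2+ q ^ m * z))  ≡⟨ ord-p* q 1≤P^m*z ⟩
  suc (ord (2+ q) (2+ q ^ m * z))     ≡⟨ cong suc (ord-p^* q m P∤z) ⟩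
  suc m                               ∎
  where
  open ≡-Reasoning
  instance _ = m^n≢0 (2+ q) m
  instance _ = ∤⇒nonZero P∤z
  1≤P^m*z : 1 ≤ 2+ q ^ m * z
  1≤P^m*z = >-nonZero⁻¹ _ {{m*n≢0 (2+ q ^ m) z}}

factorise : ∀ q x → 1 ≤ x → ∃₂ λ m z → x ≡ 2+ q ^ m * z × ¬ 2+ q ∣ z
factorise q = <-rec _ step
  where
  P = 2+ q
  step : ∀ x → (∀ {y} → y < x → 1 ≤ y → ∃₂ λ m z → y ≡ P ^ m * z × ¬ P ∣ z) →
         1 ≤ x → ∃₂ λ m z → x ≡ P ^ m * z × ¬ P ∣ z
  step x rec 1≤x with P ∣? x
  ... | no  P∤x = 0 , x , sym (*-identityˡ x) , P∤x
  ... | yes (divides c refl) with rec (m<m*n c P (s≤s (s≤s z≤n))) (>-nonZero⁻¹ c)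
    where instance _ = m*n≢0⇒m≢0 c {{>-nonZero 1≤x}}
  ...   | m , z , refl , P∤z = suc m , z , rearrange , P∤z
    where
    rearrange : P ^ m * z * P ≡ P * P ^ m * z
    rearrange = trans (*-comm (P ^ m * z) P) (sym (*-assoc P (P ^ m) z))

ord-* : ∀ {p} → Prime p → ∀ {x y} → 1 ≤ x → 1 ≤ y → ord p (x * y) ≡ ord p x + ord p y
ord-* {2+ q} pr {x} {y} 1≤x 1≤y with factorise q x 1≤x | factorise q y 1≤y
... | a , z , refl , P∤z | b , w , refl , P∤w = begin
  ord P (P ^ a * z * (P ^ b * w))  ≡⟨ cong (ord P) (rearrange (P ^ a) (P ^ b) z w) ⟩
  ord P (P ^ a * P ^ b * (z * w))  ≡⟨ cong (λ e → ord P (e * (z * w))) (^-distribˡ-+-* P a b) ⟨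
  ord P (P ^ (a + b) * (z * w))    ≡⟨ ord-p^* q (a + b) P∤zw ⟩
  a + b                            ≡⟨ cong₂ _+_ (ord-p^* q a P∤z) (ord-p^* q b P∤w) ⟨
  ord P (P ^ a * z) + ord P (P ^ b * w) ∎
  where
  open ≡-Reasoning
  P = 2+ q
  rearrange : ∀ A B c d → A * c * (B * d) ≡ A * B * (c * d)
  rearrange = solve-∀
  P∤zw : ¬ P ∣ z * w
  P∤zw P∣zw with euclidsLemma z w pr P∣zw
  ... | inj₁ P∣z = P∤z P∣z
  ... | inj₂ P∣w = P∤w P∣w

^-monoʳ-∣ : ∀ p {m n} → m ≤ n → p ^ m ∣ p ^ n
^-monoʳ-∣ p {m} {n} m≤n = divides (p ^ (n ∸ m)) (begin
  p ^ n                ≡⟨ cong (p ^_) (m+[n∸m]≡n m≤n) ⟨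
  p ^ (m + (n ∸ m))    ≡⟨ ^-distribˡ-+-* p m (n ∸ m) ⟩
  p ^ m * p ^ (n ∸ m)  ≡⟨ *-comm (p ^ m) _ ⟩
  p ^ (n ∸ m) * p ^ m  ∎)
  where open ≡-Reasoning

^∣⇔≤ord : ∀ q {m x} → 1 ≤ x → 2+ q ^ m ∣ x ⇔ m ≤ ord (2+ q) x
^∣⇔≤ord q {m} {x} 1≤x with factorise q x 1≤x
... | a , z , refl , P∤z rewrite ord-p^* q a P∤z = mk⇔ to from
  where
  P = 2+ q
  from : m ≤ a → P ^ m ∣ P ^ a * z
  from m≤a = ∣m⇒∣m*n z (^-monoʳ-∣ P m≤a)
  to : P ^ m ∣ P ^ a * z → m ≤ a
  to P^m∣x with m ≤? a
  ... | yes m≤a = m≤a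
  ... | no  m≰a = contradiction (*-cancelˡ-∣ (P ^ a) {{m^n≢0 P a}} P^a*P∣P^a*z) P∤z
    where
    P^a*P∣P^a*z : P ^ a * P ∣ P ^ a * z
    P^a*P∣P^a*z = subst (_∣ P ^ a * z) (*-comm P (P ^ a)) (∣-trans (^-monoʳ-∣ P (≰⇒> m≰a)) P^m∣x)

∤^ : ∀ {p x} n → Prime p → ¬ p ∣ x → ¬ p ∣ x ^ n
∤^ {2+ q} zero pr p∤x p∣1 = contradiction (∣1⇒≡1 p∣1) λ ()
∤^ {x = x} (suc n) pr p∤x p∣x^[1+n] with euclidsLemma x (x ^ n) pr p∣x^[1+n]
... | inj₁ p∣x   = p∤x p∣x
... | inj₂ p∣x^n = ∤^ n pr p∤x p∣x^n

-- The repunit factor ρ_{k,L}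

ρ-suc : ∀ k L → ρ (suc k) L ≡ 1 + 10 ^ L * ρ k L
ρ-suc k L = cong (1 +_) (shift k (λ i → i))
  where
  shift : ∀ k (g : ℕ → ℕ) →
    sum (map (λ i → 10 ^ (i * L)) (applyUpTo (suc ∘′ g) k)) ≡
    10 ^ L * sum (map (λ i → 10 ^ (i * L)) (applyUpTo g k))
  shift zero    g = sym (*-zeroʳ (10 ^ L))
  shift (suc k) g = trans
    (cong₂ _+_ (^-distribˡ-+-* 10 L (g 0 * L)) (shift k (g ∘′ suc)))
    (sym (*-distribˡ-+ (10 ^ L) (10 ^ (g 0 * L)) _))

ρ-+ : ∀ a b L → ρ (a + b) L ≡ ρ a L + 10 ^ (a * L) * ρ b L
ρ-+ zero    b L = sym (+-identityʳ (ρ b L))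
ρ-+ (suc a) b L = begin
  ρ (suc (a + b)) L                                 ≡⟨ ρ-suc (a + b) L ⟩
  1 + X * ρ (a + b) L                               ≡⟨ cong (λ r → 1 + X * r) (ρ-+ a b L) ⟩
  1 + X * (ρ a L + 10 ^ (a * L) * ρ b L)            ≡⟨ distribute X (ρ a L) (10 ^ (a * L)) (ρ b L) ⟩
  (1 + X * ρ a L) + X * 10 ^ (a * L) * ρ b L        ≡⟨ cong₂ (λ r e → r + e * ρ b L) (ρ-suc a L) (^-distribˡ-+-* 10 L (a * L)) ⟨
  ρ (suc a) L + 10 ^ (L + a * L) * ρ b L            ∎
  where
  open ≡-Reasoning
  X = 10 ^ L
  distribute : ∀ X r E s → 1 + X * (r + E * s) ≡ (1 + X * r) + X * E * s
  distribute = solve-∀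

ρ-sucʳ : ∀ k L → ρ (suc k) L ≡ ρ k L + 10 ^ (k * L)
ρ-sucʳ k L = begin
  ρ (suc k) L                     ≡⟨ cong (λ m → ρ m L) (+-comm 1 k) ⟩
  ρ (k + 1) L                     ≡⟨ ρ-+ k 1 L ⟩
  ρ k L + 10 ^ (k * L) * 1        ≡⟨ cong (ρ k L +_) (*-identityʳ _) ⟩
  ρ k L + 10 ^ (k * L)            ∎
  where open ≡-Reasoning

ρ-* : ∀ k j L → ρ (k * j) L ≡ ρ k L * ρ j (k * L)
ρ-* k zero    L = trans (cong (λ n → ρ n L) (*-zeroʳ k)) (sym (*-zeroʳ (ρ k L)))
ρ-* k (suc j) L = begin
  ρ (k * suc j) L                                 ≡⟨ cong (λ n → ρ n L) (*-suc k j) ⟩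
  ρ (k + k * j) L                                 ≡⟨ ρ-+ k (k * j) L ⟩
  ρ k L + 10 ^ (k * L) * ρ (k * j) L              ≡⟨ cong (λ r → ρ k L + 10 ^ (k * L) * r) (ρ-* k j L) ⟩
  ρ k L + 10 ^ (k * L) * (ρ k L * ρ j (k * L))    ≡⟨ factor (ρ k L) (10 ^ (k * L)) (ρ j (k * L)) ⟩
  ρ k L * (1 + 10 ^ (k * L) * ρ j (k * L))        ≡⟨ cong (ρ k L *_) (ρ-suc j (k * L)) ⟨
  ρ k L * ρ (suc j) (k * L)                       ∎
  where
  open ≡-Reasoning
  factor : ∀ r E s → r + E * (r * s) ≡ r * (1 + E * s)
  factor = solve-∀

ρ-geometric : ∀ k L → ρ k L * (10 ^ L ∸ 1) ≡ (10 ^ L) ^ k ∸ 1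
ρ-geometric k L = sym (trans (cong (_∸ 1) (sym (closed k))) (m+n∸n≡m _ 1))
  where
  X = 10 ^ L
  X≡1+[X∸1] : X ≡ 1 + (X ∸ 1)
  X≡1+[X∸1] = sym (m+[n∸m]≡n (m^n>0 10 L))
  closed : ∀ k → ρ k L * (X ∸ 1) + 1 ≡ X ^ k
  closed zero    = refl
  closed (suc k) = begin
    ρ (suc k) L * (X ∸ 1) + 1              ≡⟨ cong (λ r → r * (X ∸ 1) + 1) (ρ-suc k L) ⟩
    (1 + X * ρ k L) * (X ∸ 1) + 1          ≡⟨ cong (λ x → (1 + x * ρ k L) * (X ∸ 1) + 1) X≡1+[X∸1] ⟩
    (1 + (1 + (X ∸ 1)) * ρ k L) * (X ∸ 1) + 1 ≡⟨ expand (X ∸ 1) (ρ k L) ⟩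
    (1 + (X ∸ 1)) * (ρ k L * (X ∸ 1) + 1)  ≡⟨ cong₂ _*_ (sym X≡1+[X∸1]) (closed k) ⟩
    X * X ^ k                              ∎
    where
    open ≡-Reasoning
    expand : ∀ Y r → (1 + (1 + Y) * r) * Y + 1 ≡ (1 + Y) * (r * Y + 1)
    expand = solve-∀

1≤ρ : ∀ {k} L → 1 ≤ k → 1 ≤ ρ k L
1≤ρ {suc k} L _ = subst (1 ≤_) (sym (ρ-suc k L)) (s≤s z≤n)

∤ρ : ∀ {d k L} → 1 < d → d ∣ 10 → 1 ≤ k → 1 ≤ L → ¬ d ∣ ρ k L
∤ρ {d} {suc k} {suc L} 1<d d∣10 _ _ d∣ρ = <⇒≢ 1<d (sym (∣1⇒≡1 d∣1))
  where
  d∣10^[1+L]*ρ : d ∣ 10 ^ suc L * ρ k (suc L)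
  d∣10^[1+L]*ρ = ∣m⇒∣m*n (ρ k (suc L)) (∣m⇒∣m*n (10 ^ L) d∣10)
  d∣1 : d ∣ 1
  d∣1 = ∣m+n∣m⇒∣n (subst (d ∣_) (trans (ρ-suc k (suc L)) (+-comm 1 _)) d∣ρ) d∣10^[1+L]*ρ

-- Digits of n(k) and r(n(k))

digitsFuel-fuel : ∀ {f f' x} → x ≤ f → x ≤ f' → digitsFuel f x ≡ digitsFuel f' x
digitsFuel-fuel {zero}  {zero}   z≤n _   = refl
digitsFuel-fuel {zero}  {suc f'} z≤n _   = refl
digitsFuel-fuel {suc f} {zero}   _   z≤n = refl
digitsFuel-fuel {suc f} {suc f'} {zero} _ _ = refl
digitsFuel-fuel {suc f} {suc f'} {suc x} x≤f x≤f' =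
  cong (suc x % 10 ∷_) (digitsFuel-fuel ([1+y]/[2+q]≤f 8 x≤f) ([1+y]/[2+q]≤f 8 x≤f'))

digits-suc : ∀ x → digits (suc x) ≡ suc x % 10 ∷ digits (suc x / 10)
digits-suc x = cong (suc x % 10 ∷_) (digitsFuel-fuel {x} {suc x / 10} ([1+y]/[2+q]≤f 8 ≤-refl) ≤-refl)

len-suc : ∀ x → len (suc x) ≡ suc (len (suc x / 10))
len-suc x = cong length (digits-suc x)

len≡0⇒≡0 : ∀ {x} → len x ≡ 0 → x ≡ 0
len≡0⇒≡0 {zero}  _ = refl
len≡0⇒≡0 {suc x} e = contradiction (trans (sym (len-suc x)) e) λ ()

1≤len : ∀ {x} → 1 ≤ x → 1 ≤ len x
1≤len {suc x} _ = subst (1 ≤_) (sym (len-suc x)) (s≤s z≤n)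

digits-++ : ∀ M {a} b → len a ≡ M → digits (a + 10 ^ M * b) ≡ digits a ++ digits b
digits-++ zero    {a} b e with len≡0⇒≡0 {a} e
... | refl = cong digits (+-identityʳ b)
digits-++ (suc M) {suc a} b e = begin
  digits (suc a + 10 ^ suc M * b)                ≡⟨ digits-suc (a + 10 ^ suc M * b) ⟩
  suc (a + 10 ^ suc M * b) % 10 ∷ digits (suc (a + 10 ^ suc M * b) / 10)
                                                 ≡⟨ cong₂ (λ d x → d ∷ digits x) %-step /-step ⟩
  suc a % 10 ∷ digits (suc a / 10 + c)           ≡⟨ cong (suc a % 10 ∷_) (digits-++ M {suc a / 10} b len≡M) ⟩
  suc a % 10 ∷ digits (suc a / 10) ++ digits b   ≡⟨ cong (_++ digits b) (digits-suc a) ⟨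
  digits (suc a) ++ digits b                     ∎
  where
  open ≡-Reasoning
  c = 10 ^ M * b
  len≡M : len (suc a / 10) ≡ M
  len≡M = suc-injective (trans (sym (len-suc a)) e)
  shape : suc a + 10 ^ suc M * b ≡ suc a + c * 10
  shape = cong (suc a +_) (trans (*-assoc 10 (10 ^ M) b) (*-comm 10 c))
  %-step : suc (a + 10 ^ suc M * b) % 10 ≡ suc a % 10
  %-step = trans (cong (_% 10) shape) ([m+kn]%n≡m%n (suc a) c 10)
  /-step : suc (a + 10 ^ suc M * b) / 10 ≡ suc a / 10 + c
  /-step = trans (cong (_/ 10) shape)
    (trans (+-distrib-/-∣ʳ (suc a) (n∣m*n c)) (cong (suc a / 10 +_) (m*n/n≡m c 10)))

rep-suc : ∀ n k → rep n (suc k) ≡ n + 10 ^ len n * rep n k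
rep-suc n k = trans (cong (n *_) (ρ-suc k (len n))) (distribute n (10 ^ len n) (ρ k (len n)))
  where
  distribute : ∀ n X r → n * (1 + X * r) ≡ n + X * (n * r)
  distribute = solve-∀

digits-rep-suc : ∀ n k → digits (rep n (suc k)) ≡ digits n ++ digits (rep n k)
digits-rep-suc n k = trans (cong digits (rep-suc n k)) (digits-++ (len n) {n} (rep n k) refl)

len-rep : ∀ n k → len (rep n k) ≡ k * len n
len-rep n zero    = cong len (*-zeroʳ n)
len-rep n (suc k) = begin
  length (digits (rep n (suc k)))            ≡⟨ cong length (digits-rep-suc n k) ⟩
  length (digits n ++ digits (rep n k))      ≡⟨ length-++ (digits n) {digits (rep n k)} ⟩
  len n + len (rep n k)                      ≡⟨ cong (len n +_) (len-rep n k) ⟩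
  len n + k * len n                          ∎
  where open ≡-Reasoning

foldl-digits : ∀ ds acc → foldl (λ acc d → acc * 10 + d) acc ds ≡
               acc * 10 ^ length ds + foldl (λ acc d → acc * 10 + d) 0 ds
foldl-digits []       acc = sym (trans (+-identityʳ _) (*-identityʳ acc))
foldl-digits (d ∷ ds) acc = begin
  foldl step (acc * 10 + d) ds                       ≡⟨ foldl-digits ds (acc * 10 + d) ⟩
  (acc * 10 + d) * 10 ^ length ds + foldl step 0 ds  ≡⟨ regroup acc d (10 ^ length ds) _ ⟩
  acc * (10 * 10 ^ length ds) + (d * 10 ^ length ds + foldl step 0 ds)
                                                     ≡⟨ cong (acc * 10 ^ suc (length ds) +_) (foldl-digits ds d) ⟨
  acc * 10 ^ suc (length ds) + foldl step d ds       ∎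
  where
  open ≡-Reasoning
  step : ℕ → ℕ → ℕ
  step acc d = acc * 10 + d
  regroup : ∀ a d X F → (a * 10 + d) * X + F ≡ a * (10 * X) + (d * X + F)
  regroup = solve-∀

rev-rep : ∀ n k → rev (rep n k) ≡ rev n * ρ k (len n)
rev-rep n zero    = trans (cong rev (*-zeroʳ n)) (sym (*-zeroʳ (rev n)))
rev-rep n (suc k) = begin
  foldl step 0 (digits (rep n (suc k)))                 ≡⟨ cong (foldl step 0) (digits-rep-suc n k) ⟩
  foldl step 0 (digits n ++ digits (rep n k))           ≡⟨ foldl-++ step 0 (digits n) (digits (rep n k)) ⟩
  foldl step (rev n) (digits (rep n k))                 ≡⟨ foldl-digits (digits (rep n k)) (rev n) ⟩
  rev n * 10 ^ len (rep n k) + rev (rep n k)            ≡⟨ cong₂ (λ l r → rev n * 10 ^ l + r) (len-rep n k) (rev-rep n k) ⟩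
  rev n * 10 ^ (k * L) + rev n * ρ k L                  ≡⟨ +-comm _ (rev n * ρ k L) ⟩
  rev n * ρ k L + rev n * 10 ^ (k * L)                  ≡⟨ *-distribˡ-+ (rev n) _ _ ⟨
  rev n * (ρ k L + 10 ^ (k * L))                        ≡⟨ cong (rev n *_) (ρ-sucʳ k L) ⟨
  rev n * ρ (suc k) L                                   ∎
  where
  open ≡-Reasoning
  L = len n
  step : ℕ → ℕ → ℕ
  step acc d = acc * 10 + d

1≤rev : ∀ {n} → 1 ≤ n → ¬ 10 ∣ n → 1 ≤ rev n
1≤rev {suc n} _ 10∤n = begin
  1                                         ≤⟨ 1≤lastDigit ⟩
  d                                         ≤⟨ m≤m*n d (10 ^ length ds) {{m^n≢0 10 (length ds)}} ⟩
  d * 10 ^ length ds                        ≤⟨ m≤m+n _ _ ⟩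
  d * 10 ^ length ds + rev (suc n / 10)     ≡⟨ foldl-digits ds d ⟨
  foldl (λ acc d → acc * 10 + d) d ds       ≡⟨ cong (foldl (λ acc d → acc * 10 + d) 0) (digits-suc n) ⟨
  rev (suc n)                               ∎
  where
  open ≤-Reasoning
  d = suc n % 10
  ds = digits (suc n / 10)
  1≤lastDigit : 1 ≤ d
  1≤lastDigit with suc n % 10 in e
  ... | zero  = contradiction (m%n≡0⇒n∣m (suc n) 10 e) 10∤n
  ... | suc _ = s≤s z≤n

-- Multiplicative order

findSuc : (ℕ → Bool) → List ℕ → ℕ
findSuc P []       = 0
findSuc P (t ∷ ts) = if P (suc t) then suc t else findSuc P ts

findSuc-unique : ∀ P (G : List ℕ → ℕ) → G [] ≡ 0 →
  (∀ t ts → G (t ∷ ts) ≡ (if P (suc t) then suc t else G ts)) → ∀ ts → G ts ≡ findSuc P ts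
findSuc-unique P G G[] G∷ []       = G[]
findSuc-unique P G G[] G∷ (t ∷ ts) rewrite G∷ t ts | findSuc-unique P G G[] G∷ ts = refl

-- The search inside `multOrder` is captured as in `ord≡ordLoop`.
multOrder≡findSuc : ∀ x m → .{{_ : NonZero m}} →
  multOrder x m ≡ findSuc (λ t → x ^ t % m ≡ᵇ 1 % m) (upTo m)
multOrder≡findSuc x (suc m') = unfold x m'
  where
  loop : Σ (ℕ → ℕ → List ℕ → ℕ) λ G →
         ∀ x m' ts → G x m' ts ≡ findSuc (λ t → x ^ t % suc m' ≡ᵇ 1 % suc m') ts
  loop = _ , λ x m' → findSuc-unique _ _ refl (λ _ _ → refl)
  unfold : ∀ x m' → multOrder x (suc m') ≡ findSuc (λ t → x ^ t % suc m' ≡ᵇ 1 % suc m') (upTo (suc m'))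
  unfold x m' with applyUpTo suc m'
  ... | ts = cong (if x ^ 1 % suc m' ≡ᵇ 1 % suc m' then 1 else_) (proj₂ loop x m' ts)

findSuc-++-suc : ∀ P xs ys {t} → findSuc P xs ≡ suc t → findSuc P (xs ++ ys) ≡ suc t
findSuc-++-suc P (x ∷ xs) ys e with P (suc x)
... | true  = e
... | false = findSuc-++-suc P xs ys e

findSuc-++-0 : ∀ P xs ys → findSuc P xs ≡ 0 → findSuc P (xs ++ ys) ≡ findSuc P ys
findSuc-++-0 P []       ys e = refl
findSuc-++-0 P (x ∷ xs) ys e with P (suc x)
... | false = findSuc-++-0 P xs ys e

Least : (ℕ → Bool) → ℕ → Set
Least P t = P (suc t) ≡ true × (∀ {s} → s < t → P (suc s) ≡ false)

FindSucOutcome : (ℕ → Bool) → List ℕ → ℕ → Set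
FindSucOutcome P ts n = (findSuc P ts ≡ 0 × (∀ {s} → s < n → P (suc s) ≡ false))
                      ⊎ (∃ λ t → findSuc P ts ≡ suc t × Least P t)

findSuc-upTo : ∀ P n → FindSucOutcome P (upTo n) n
findSuc-upTo P zero    = inj₁ (refl , λ ())
findSuc-upTo P (suc n) = subst (λ ts → FindSucOutcome P ts (suc n)) (upTo-∷ʳ n) (extend (findSuc-upTo P n))
  where
  extend : FindSucOutcome P (upTo n) n → FindSucOutcome P (upTo n ∷ʳ n) (suc n)
  extend (inj₂ (t , e , least)) = inj₂ (t , findSuc-++-suc P (upTo n) _ e , least)
  extend (inj₁ (e , none)) rewrite findSuc-++-0 P (upTo n) (n ∷ []) e with P (suc n) in Pn
  ... | true  = inj₂ (n , refl , Pn , none)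
  ... | false = inj₁ (refl , λ s<1+n → [ none , (λ { refl → Pn }) ]′ (m≤n⇒m<n∨m≡n (≤-pred s<1+n)))

findSuc-least : ∀ P n {d} → d < n → P (suc d) ≡ true → ∃ λ t → findSuc P (upTo n) ≡ suc t × Least P t
findSuc-least P n d<n Pd with findSuc-upTo P n
... | inj₁ (_ , none) = contradiction (trans (sym Pd) (none d<n)) λ ()
... | inj₂ found      = found

pow%-+ : ∀ x {m} .{{_ : NonZero m}} {a b} →
  x ^ a % m ≡ 1 % m → x ^ b % m ≡ 1 % m → x ^ (a + b) % m ≡ 1 % m
pow%-+ x {m} {a} {b} xa xb = begin
  x ^ (a + b) % m                    ≡⟨ cong (_% m) (^-distribˡ-+-* x a b) ⟩
  (x ^ a * x ^ b) % m                ≡⟨ %-distribˡ-* (x ^ a) (x ^ b) m ⟩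
  ((x ^ a % m) * (x ^ b % m)) % m    ≡⟨ cong₂ (λ u v → (u * v) % m) xa xb ⟩
  ((1 % m) * (1 % m)) % m            ≡⟨ %-distribˡ-* 1 1 m ⟨
  1 % m                              ∎
  where open ≡-Reasoning

pow%-cancelˡ : ∀ x {m} .{{_ : NonZero m}} {a b} →
  x ^ (a + b) % m ≡ 1 % m → x ^ a % m ≡ 1 % m → x ^ b % m ≡ 1 % m
pow%-cancelˡ x {m} {a} {b} xab xa = begin
  x ^ b % m                          ≡⟨ cong (_% m) (*-identityˡ (x ^ b)) ⟨
  (1 * x ^ b) % m                    ≡⟨ %-distribˡ-* 1 (x ^ b) m ⟩
  ((1 % m) * (x ^ b % m)) % m        ≡⟨ cong (λ u → (u * (x ^ b % m)) % m) xa ⟨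
  ((x ^ a % m) * (x ^ b % m)) % m    ≡⟨ %-distribˡ-* (x ^ a) (x ^ b) m ⟨
  (x ^ a * x ^ b) % m                ≡⟨ cong (_% m) (^-distribˡ-+-* x a b) ⟨
  x ^ (a + b) % m                    ≡⟨ xab ⟩
  1 % m                              ∎
  where open ≡-Reasoning

pow%-* : ∀ x {m} .{{_ : NonZero m}} {h} c → x ^ h % m ≡ 1 % m → x ^ (h * c) % m ≡ 1 % m
pow%-* x {m} {h} zero    _  = cong (λ e → x ^ e % m) (*-zeroʳ h)
pow%-* x {m} {h} (suc c) xh =
  subst (λ e → x ^ e % m ≡ 1 % m) (sym (*-suc h c)) (pow%-+ x {a = h} xh (pow%-* x {h = h} c xh))

%≡%⇒∣∸ : ∀ a b {m} .{{_ : NonZero m}} → a % m ≡ b % m → m ∣ a ∸ b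
%≡%⇒∣∸ a b {m} a≡b = divides (a / m ∸ b / m) (begin
  a ∸ b                                        ≡⟨ cong₂ _∸_ (m≡m%n+[m/n]*n a m) (m≡m%n+[m/n]*n b m) ⟩
  (a % m + a / m * m) ∸ (b % m + b / m * m)    ≡⟨ cong (λ r → (r + a / m * m) ∸ (b % m + b / m * m)) a≡b ⟩
  (b % m + a / m * m) ∸ (b % m + b / m * m)    ≡⟨ [m+n]∸[m+o]≡n∸o (b % m) _ _ ⟩
  a / m * m ∸ b / m * m                        ≡⟨ *-distribʳ-∸ m (a / m) (b / m) ⟨
  (a / m ∸ b / m) * m                          ∎)
  where open ≡-Reasoning

%≡1⇔∣∸1 : ∀ {a m} .{{_ : NonZero m}} → 1 ≤ a → a % m ≡ 1 % m ⇔ m ∣ a ∸ 1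
%≡1⇔∣∸1 {a} {m} 1≤a = mk⇔ (%≡%⇒∣∸ a 1) λ m∣a∸1 →
  trans (cong (_% m) (sym (m∸n+n≡m 1≤a))) (%-remove-+ˡ 1 m∣a∸1)

^∣-cancelˡ : ∀ {p a c} e → Prime p → ¬ p ∣ a → p ^ e ∣ a * c → p ^ e ∣ c
^∣-cancelˡ {p} {a} {zero}  e pr p∤a _ = _ ∣0
^∣-cancelˡ {2+ q} {a} {suc c} e pr p∤a p^e∣ac = Equivalence.from (^∣⇔≤ord q (s≤s z≤n)) (begin
  e                                  ≤⟨ Equivalence.to (^∣⇔≤ord q 1≤ac) p^e∣ac ⟩
  ord (2+ q) (a * suc c)             ≡⟨ ord-* pr 1≤a (s≤s z≤n) ⟩
  ord (2+ q) a + ord (2+ q) (suc c)  ≡⟨ cong (_+ ord (2+ q) (suc c)) (∤⇒ord≡0 (2+ q) p∤a) ⟩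
  ord (2+ q) (suc c)                 ∎)
  where
  open ≤-Reasoning
  instance _ = ∤⇒nonZero p∤a
  1≤a : 1 ≤ a
  1≤a = >-nonZero⁻¹ a
  1≤ac : 1 ≤ a * suc c
  1≤ac = *-mono-≤ 1≤a (s≤s z≤n)

-- Pigeonhole on the residues of x ^ 0, …, x ^ m, then cancel the smaller power (p ∤ x).
pow%-period : ∀ {p x} e → Prime p → ¬ p ∣ x → let m = p ^ e in .{{_ : NonZero m}} →
  ∃ λ d → d < m × x ^ suc d % m ≡ 1 % m
pow%-period {p} {x} e pr p∤x with pigeonhole (n<1+n (p ^ e)) residue
  where
  residue : Fin (suc (p ^ e)) → Fin (p ^ e)
  residue i = fromℕ< (m%n<n (x ^ toℕ i) (p ^ e))
... | i , j , i<j , same =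
  d , d<m , Equivalence.from (%≡1⇔∣∸1 (m^n>0 x {{∤⇒nonZero p∤x}} (suc d))) m∣x^[1+d]∸1
  where
  m = p ^ e
  a = toℕ i
  d = toℕ j ∸ suc a
  j≡a+[1+d] : toℕ j ≡ a + suc d
  j≡a+[1+d] = sym (trans (+-suc a d) (m+[n∸m]≡n i<j))
  d<m : d < m
  d<m = ≤-trans (s≤s (m≤n+m d a)) (subst (_≤ m) (trans j≡a+[1+d] (+-suc a d)) (≤-pred (toℕ<n j)))
  x^a≡x^j : x ^ a % m ≡ x ^ toℕ j % m
  x^a≡x^j = trans (sym (toℕ-fromℕ< (m%n<n (x ^ a) m)))
                  (trans (cong toℕ same) (toℕ-fromℕ< (m%n<n (x ^ toℕ j) m)))
  x^j∸x^a : x ^ toℕ j ∸ x ^ a ≡ x ^ a * (x ^ suc d ∸ 1)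
  x^j∸x^a = begin
    x ^ toℕ j ∸ x ^ a                  ≡⟨ cong₂ _∸_ x^j≡ (sym (*-identityʳ (x ^ a))) ⟩
    x ^ a * x ^ suc d ∸ x ^ a * 1      ≡⟨ *-distribˡ-∸ (x ^ a) (x ^ suc d) 1 ⟨
    x ^ a * (x ^ suc d ∸ 1)            ∎
    where
    open ≡-Reasoning
    x^j≡ : x ^ toℕ j ≡ x ^ a * x ^ suc d
    x^j≡ = trans (cong (x ^_) j≡a+[1+d]) (^-distribˡ-+-* x a (suc d))
  m∣x^[1+d]∸1 : m ∣ x ^ suc d ∸ 1
  m∣x^[1+d]∸1 = ^∣-cancelˡ e pr (∤^ a pr p∤x)
    (subst (m ∣_) x^j∸x^a (%≡%⇒∣∸ (x ^ toℕ j) (x ^ a) (sym x^a≡x^j)))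

multOrder-least : ∀ {p x} e → Prime p → ¬ p ∣ x → let m = p ^ e in .{{_ : NonZero m}} →
  ∃ λ t → multOrder x m ≡ suc t × x ^ suc t % m ≡ 1 % m × (∀ {s} → s < t → x ^ suc s % m ≢ 1 % m)
multOrder-least {p} {x} e pr p∤x with pow%-period e pr p∤x
... | d , d<m , x^[1+d]≡1
  with findSuc-least (λ t → x ^ t % p ^ e ≡ᵇ 1 % p ^ e) (p ^ e) d<m (≡⇒≡ᵇ-true x^[1+d]≡1)
... | t , found , hit , below =
  t , trans (multOrder≡findSuc x (p ^ e)) found , ≡ᵇ-true⇒≡ hit ,
  λ s<t x^[1+s]≡1 → contradiction (trans (sym (≡⇒≡ᵇ-true x^[1+s]≡1)) (below s<t)) λ ()

multOrder-∣⇔ : ∀ {p x} e K → Prime p → ¬ p ∣ x → .{{_ : NonZero (p ^ e)}} →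
  multOrder x (p ^ e) ∣ K ⇔ p ^ e ∣ x ^ K ∸ 1
multOrder-∣⇔ {p} {x} e K pr p∤x with multOrder-least e pr p∤x
... | t , order≡1+t , x^[1+t]≡1 , below rewrite order≡1+t =
  mk⇔ (to (%≡1⇔∣∸1 1≤x^K) ∘ x^K≡1) (1+t∣K ∘ from (%≡1⇔∣∸1 1≤x^K))
  where
  open Equivalence
  m = p ^ e
  1≤x^K : 1 ≤ x ^ K
  1≤x^K = m^n>0 x {{∤⇒nonZero p∤x}} K
  x^K≡1 : suc t ∣ K → x ^ K % m ≡ 1 % m
  x^K≡1 (divides c refl) = subst (λ n → x ^ n % m ≡ 1 % m) (*-comm (suc t) c) (pow%-* x {h = suc t} c x^[1+t]≡1)
  1+t∣K : x ^ K % m ≡ 1 % m → suc t ∣ K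
  1+t∣K x^K≡1 with K % suc t in r≡
  ... | zero  = m%n≡0⇒n∣m K (suc t) r≡
  ... | suc s = contradiction x^[1+s]≡1 (below s<t)
    where
    K≡ : K ≡ suc t * (K / suc t) + suc s
    K≡ = trans (m≡m%n+[m/n]*n K (suc t))
           (trans (+-comm (K % suc t) _) (cong₂ _+_ (*-comm (K / suc t) (suc t)) r≡))
    x^[1+s]≡1 : x ^ suc s % m ≡ 1 % m
    x^[1+s]≡1 = pow%-cancelˡ x {a = suc t * (K / suc t)}
      (subst (λ n → x ^ n % m ≡ 1 % m) K≡ x^K≡1) (pow%-* x {h = suc t} (K / suc t) x^[1+t]≡1)
    s<t : s < t
    s<t = ≤-pred (subst (_< suc t) r≡ (m%n<n K (suc t)))

h∣⇔≤ord-ρ : ∀ {p} α L K → Prime p → ¬ p ∣ 10 → 1 ≤ L → 1 ≤ K → h p α L ∣ K ⇔ α ≤ ord p (ρ K L)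
h∣⇔≤ord-ρ {2+ q} α L K pr p∤10 1≤L 1≤K = begin
  h p α L ∣ K                         ≈⟨ multOrder-∣⇔ (α + e) K pr (∤^ L pr p∤10) ⟩
  p ^ (α + e) ∣ X ^ K ∸ 1              ≈⟨ ^∣⇔≤ord q 1≤X^K∸1 ⟩
  α + e ≤ ord p (X ^ K ∸ 1)            ≡⟨ cong (α + e ≤_) ord-X^K∸1 ⟩
  α + e ≤ ord p (ρ K L) + e            ≈⟨ mk⇔ (+-cancelʳ-≤ e α _) (+-monoˡ-≤ e) ⟩
  α ≤ ord p (ρ K L)                    ∎
  where
  open import Relation.Binary.Reasoning.Setoid (⇔-setoid 0ℓ)
  p = 2+ q
  X = 10 ^ L
  e = ord p (X ∸ 1)
  instance _ = m^n≢0 p (α + e)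
  1≤X∸1 : 1 ≤ X ∸ 1
  1≤X∸1 = ≤-trans (s≤s z≤n) (∸-monoˡ-≤ 1 (^-monoʳ-≤ 10 1≤L))
  1≤X^K∸1 : 1 ≤ X ^ K ∸ 1
  1≤X^K∸1 = subst (1 ≤_) (ρ-geometric K L) (*-mono-≤ (1≤ρ L 1≤K) 1≤X∸1)
  ord-X^K∸1 : ord p (X ^ K ∸ 1) ≡ ord p (ρ K L) + e
  ord-X^K∸1 = trans (cong (ord p) (sym (ρ-geometric K L))) (ord-* pr (1≤ρ L 1≤K) 1≤X∸1)

-- The cases D(p, δ, u, μ)

CaseCondition : ℕ → ℕ → ℕ → ℕ → Case → Set
CaseCondition p δ u μ cI   = (φ p δ 0 ≡ u × μ ≡ 0) ⊎ (φ p δ 1 ≡ u × μ ≡ 1)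
CaseCondition p δ u μ cII  = φ p δ 1 ≡ u × μ ≡ 0
CaseCondition p δ u μ cIII = φ p δ 0 ≡ u × φ p δ 1 ≡ u × μ ≡ 0
CaseCondition p δ u μ cIV  = φ p δ 2 ≡ u × μ ≡ 1
CaseCondition p δ u μ cV   = φ p δ 2 ≡ u × μ ≡ 0
CaseCondition p δ u μ cVI  = φ p δ 2 ≡ u × 2 ≤ μ
CaseCondition p δ u μ cVII = ⊤

D-sound : ∀ p δ u μ → CaseCondition p δ u μ (D p δ u μ)
D-sound p δ u μ with φ p δ 0 ≡ᵇ u in e₀ | φ p δ 1 ≡ᵇ u in e₁ | φ p δ 2 ≡ᵇ u in e₂ | μ
... | true  | true  | true  | _             = tt
... | true  | true  | false | zero          = ≡ᵇ-true⇒≡ e₀ , ≡ᵇ-true⇒≡ e₁ , refl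
... | true  | true  | false | suc zero      = inj₂ (≡ᵇ-true⇒≡ e₁ , refl)
... | true  | true  | false | suc (suc _)   = tt
... | true  | false | true  | _             = tt
... | true  | false | false | zero          = inj₁ (≡ᵇ-true⇒≡ e₀ , refl)
... | true  | false | false | suc _         = tt
... | false | true  | true  | _             = tt
... | false | true  | false | zero          = ≡ᵇ-true⇒≡ e₁ , refl
... | false | true  | false | suc zero      = inj₂ (≡ᵇ-true⇒≡ e₁ , refl)
... | false | true  | false | suc (suc _)   = tt
... | false | false | true  | zero          = ≡ᵇ-true⇒≡ e₂ , refl
... | false | false | true  | suc zero      = ≡ᵇ-true⇒≡ e₂ , refl
... | false | false | true  | suc (suc _)   = ≡ᵇ-true⇒≡ e₂ , s≤s (s≤s z≤n)
... | false | false | false | _             = tt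

-- What K ∈ S(A_p, B_p) says about t = ord_p ρ_{K,L} in each case.
OrdCondition : Case → ℕ → Set
OrdCondition cI   t = t ≡ 0
OrdCondition cII  t = t ≡ 1
OrdCondition cIII t = t ≤ 1
OrdCondition cIV  t = 1 ≤ t
OrdCondition cV   t = 2 ≤ t
OrdCondition cVI  t = ⊤
OrdCondition cVII t = ⊥

φ-≥2 : ∀ p δ {n} → 2 ≤ n → φ p δ n ≡ φ p δ 2
φ-≥2 p δ             {1}    (s≤s ())
φ-≥2 p zero          {2+ n} _ = refl
φ-≥2 p (suc zero)    {2+ n} _ with p ≡ᵇ 2
... | true  = refl
... | false = refl
φ-≥2 p (suc (suc δ)) {2+ n} _ = refl

φ-of-case : ∀ {p δ u μ} c t → CaseCondition p δ u μ c → OrdCondition c t → u ≡ φ p δ (μ + t)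
φ-of-case cI   t (inj₁ (φ0≡u , refl)) refl = sym φ0≡u
φ-of-case cI   t (inj₂ (φ1≡u , refl)) refl = sym φ1≡u
φ-of-case cII  t (φ1≡u , refl) refl = sym φ1≡u
φ-of-case cIII zero    (φ0≡u , _ , refl) _ = sym φ0≡u
φ-of-case cIII (suc _) (_ , φ1≡u , refl) (s≤s z≤n) = sym φ1≡u
φ-of-case {p} {δ} cIV t (φ2≡u , refl) 1≤t = sym (trans (φ-≥2 p δ (s≤s 1≤t)) φ2≡u)
φ-of-case {p} {δ} cV  t (φ2≡u , refl) 2≤t = sym (trans (φ-≥2 p δ 2≤t) φ2≡u)
φ-of-case {p} {δ} {μ = μ} cVI t (φ2≡u , 2≤μ) _ = sym (trans (φ-≥2 p δ (≤-trans 2≤μ (m≤m+n μ t))) φ2≡u)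

prime∣10 : ∀ {p} → Prime p → p ∣ 10 → p ≡ 2 ⊎ p ≡ 5
prime∣10 pr p∣10 with euclidsLemma 2 5 pr p∣10
... | inj₁ p∣2 = [ (λ { refl → contradiction pr ¬prime[1] }) , inj₁ ]′ (prime⇒irreducible prime[2] p∣2)
... | inj₂ p∣5 = [ (λ { refl → contradiction pr ¬prime[1] }) , inj₂ ]′ (prime⇒irreducible prime[5] p∣5)
  where
  prime[5] : Prime 5
  prime[5] = from-yes (prime? 5)

ord-ρ-2,5 : ∀ {p K L} → p ≡ 2 ⊎ p ≡ 5 → 1 ≤ K → 1 ≤ L → ord p (ρ K L) ≡ 0
ord-ρ-2,5 {p} p∈2,5 1≤K 1≤L = ∤⇒ord≡0 p (∤ρ (1<p p∈2,5) (p∣10 p∈2,5) 1≤K 1≤L)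
  where
  1<p : p ≡ 2 ⊎ p ≡ 5 → 1 < p
  1<p (inj₁ refl) = s≤s (s≤s z≤n)
  1<p (inj₂ refl) = s≤s (s≤s z≤n)
  p∣10 : p ≡ 2 ⊎ p ≡ 5 → p ∣ 10
  p∣10 (inj₁ refl) = divides 5 refl
  p∣10 (inj₂ refl) = divides 2 refl

is2or5 : ℕ → Bool
is2or5 p = (p ≡ᵇ 2) ∨ (p ≡ᵇ 5)

is2or5-true : ∀ {p} → is2or5 p ≡ true → p ≡ 2 ⊎ p ≡ 5
is2or5-true {p} e with p ≡ᵇ 2 in e₂ | p ≡ᵇ 5 in e₅
... | true  | _    = inj₁ (≡ᵇ-true⇒≡ e₂)
... | false | true = inj₂ (≡ᵇ-true⇒≡ e₅)

is2or5-false : ∀ {p} → Prime p → is2or5 p ≡ false → ¬ p ∣ 10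
is2or5-false pr e p∣10 with prime∣10 pr p∣10
... | inj₁ refl = contradiction e λ ()
... | inj₂ refl = contradiction e λ ()

module _ {N p K} (pr : Prime p) (1≤L : 1 ≤ len N) (1≤K : 1 ≤ K) where
  open Equivalence using (to; from)

  private
    t≡0 : is2or5 p ≡ true → ord p (ρ K (len N)) ≡ 0
    t≡0 e = ord-ρ-2,5 (is2or5-true {p} e) 1≤K 1≤L

    h∣⇔ : ∀ α → is2or5 p ≡ false → h p α (len N) ∣ K ⇔ α ≤ ord p (ρ K (len N))
    h∣⇔ α e = h∣⇔≤ord-ρ α (len N) K pr (is2or5-false pr e) 1≤L 1≤K

  AB-ordCondition : ∀ u → let a = ord p N ; b = ord p (rev N) in
    InS (proj₁ (AB N p u)) (proj₂ (AB N p u)) K →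
    OrdCondition (D p (absδ a b) u (a ∸ (a ∸ b))) (ord p (ρ K (len N)))
  AB-ordCondition u (A∣K , B∤K)
    with is2or5 p in e | D p (absδ (ord p N) (ord p (rev N))) u (ord p N ∸ (ord p N ∸ ord p (rev N)))
  ... | true  | cI   = t≡0 e
  ... | true  | cIII = subst (_≤ 1) (sym (t≡0 e)) z≤n
  ... | true  | cVI  = tt
  ... | true  | cII  = contradiction (1∣ K) (head B∤K)
  ... | true  | cIV  = contradiction (1∣ K) (head B∤K)
  ... | true  | cV   = contradiction (1∣ K) (head B∤K)
  ... | true  | cVII = contradiction (1∣ K) (head B∤K)
  ... | false | cI   = n≤0⇒n≡0 (≮⇒≥ (head B∤K ∘ from (h∣⇔ 1 e)))
  ... | false | cII  = ≤-antisym (≤-pred (≰⇒> (head B∤K ∘ from (h∣⇔ 2 e)))) (to (h∣⇔ 1 e) (head A∣K))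
  ... | false | cIII = ≤-pred (≰⇒> (head B∤K ∘ from (h∣⇔ 2 e)))
  ... | false | cIV  = to (h∣⇔ 1 e) (head A∣K)
  ... | false | cV   = to (h∣⇔ 2 e) (head A∣K)
  ... | false | cVI  = tt
  ... | false | cVII = contradiction (1∣ K) (head B∤K)

-- The type as an explicit formula

-- The argument of φ is min(ord_p N(K), ord_p r(N(K))).
typeAt : ℕ → ℕ → ℕ → ℕ
typeAt N K p =
  φ p (absδ (ord p N) (ord p (rev N))) (ord p N ∸ (ord p N ∸ ord p (rev N)) + ord p (ρ K (len N)))

InS-AB⇒≡typeAt : ∀ {N K p u} → Prime p → 1 ≤ len N → 1 ≤ K →
  InS (proj₁ (AB N p u)) (proj₂ (AB N p u)) K → u ≡ typeAt N K p
InS-AB⇒≡typeAt {N} {K} {p} {u} pr 1≤L 1≤K ins =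
  φ-of-case _ (ord p (ρ K (len N))) (D-sound p (absδ a b) u (a ∸ (a ∸ b))) (AB-ordCondition pr 1≤L 1≤K u ins)
  where
  a = ord p N
  b = ord p (rev N)

≡map-of-zip : ∀ {A B : Set} {P : A → Set} (g : A → B) {xs : List A} {ys : List B} →
  length ys ≡ length xs → All P xs →
  All (λ xy → P (proj₁ xy) → proj₂ xy ≡ g (proj₁ xy)) (zip xs ys) → ys ≡ map g xs
≡map-of-zip g {[]}     {[]}     _   _          _        = refl
≡map-of-zip g {x ∷ xs} {y ∷ ys} len (px ∷ pxs) (f ∷ fs) =
  cong₂ _∷_ (f px) (≡map-of-zip g (suc-injective len) pxs fs)

-- `crucial N` is `filterᵇ (crucialTest N) (upTo (suc (N * rev N)))` by definition.
crucialTest : ℕ → ℕ → Bool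
crucialTest N p = isPrimeᵇ p ∧ not (ord p N ≡ᵇ ord p (rev N))

crucial-prime : ∀ N → All Prime (crucial N)
crucial-prime N = All.map (λ {p} test → toWitness {a? = prime? p} (proj₁ (Equivalence.to T-∧ test)))
                          (all-filter (T? ∘ crucialTest N) (upTo (suc (N * rev N))))

IsType⇒≡typeAt : ∀ {N K u} → 1 ≤ len N → 1 ≤ K → IsType N K u → u ≡ map (typeAt N K) (crucial N)
IsType⇒≡typeAt {N} {K} 1≤L 1≤K ((length≡ , _ , _) , A∣K , B∤K) =
  ≡map-of-zip (typeAt N K) length≡ (crucial-prime N)
    (All.map (λ ins pr → InS-AB⇒≡typeAt pr 1≤L 1≤K ins)
             (All.zip (map⁻ (concat⁻ A∣K) , map⁻ (concat⁻ B∤K))))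

-- From n to n(k)

≡ᵇ-+ʳ : ∀ a b t → (a + t ≡ᵇ b + t) ≡ (a ≡ᵇ b)
≡ᵇ-+ʳ a b t = trans (cong₂ _≡ᵇ_ (+-comm a t) (+-comm b t)) (shift t)
  where
  shift : ∀ t → (t + a ≡ᵇ t + b) ≡ (a ≡ᵇ b)
  shift zero    = refl
  shift (suc t) = shift t

∸-+ʳ : ∀ a b t → (a + t) ∸ (b + t) ≡ a ∸ b
∸-+ʳ a b t = trans (cong₂ _∸_ (+-comm a t) (+-comm b t)) ([m+n]∸[m+o]≡n∸o t a b)

absδ-+ʳ : ∀ a b t → absδ (a + t) (b + t) ≡ absδ a b
absδ-+ʳ a b t = cong₂ _+_ (∸-+ʳ a b t) (∸-+ʳ b a t)

min-+ʳ : ∀ a b t → (a + t) ∸ ((a + t) ∸ (b + t)) ≡ a ∸ (a ∸ b) + t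
min-+ʳ a b t = begin
  (a + t) ∸ ((a + t) ∸ (b + t))   ≡⟨ cong ((a + t) ∸_) (∸-+ʳ a b t) ⟩
  (a + t) ∸ (a ∸ b)               ≡⟨ cong (_∸ (a ∸ b)) (+-comm a t) ⟩
  (t + a) ∸ (a ∸ b)               ≡⟨ +-∸-assoc t (m∸n≤m a b) ⟩
  t + (a ∸ (a ∸ b))               ≡⟨ +-comm t _ ⟩
  a ∸ (a ∸ b) + t                 ∎
  where open ≡-Reasoning

filterᵇ-upTo-extend : ∀ P {B B'} → B ≤ B' → (∀ {x} → B ≤ x → P x ≡ false) →
  filterᵇ P (upTo B') ≡ filterᵇ P (upTo B)
filterᵇ-upTo-extend P {B} {B'} B≤B' beyond =
  subst (λ n → filterᵇ P (upTo n) ≡ filterᵇ P (upTo B)) (m+[n∸m]≡n B≤B') (extend (B' ∸ B))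
  where
  extend : ∀ d → filterᵇ P (upTo (B + d)) ≡ filterᵇ P (upTo B)
  extend zero    = cong (filterᵇ P ∘ upTo) (+-identityʳ B)
  extend (suc d) = begin
    filterᵇ P (upTo (B + suc d))                            ≡⟨ cong (filterᵇ P ∘ upTo) (+-suc B d) ⟩
    filterᵇ P (upTo (suc (B + d)))                          ≡⟨ cong (filterᵇ P) (upTo-∷ʳ (B + d)) ⟨
    filterᵇ P (upTo (B + d) ++ B + d ∷ [])                  ≡⟨ filter-++ (T? ∘ P) (upTo (B + d)) _ ⟩
    filterᵇ P (upTo (B + d)) ++ filterᵇ P (B + d ∷ [])      ≡⟨ cong (filterᵇ P (upTo (B + d)) ++_) (filter-reject (T? ∘ P) rejected) ⟩
    filterᵇ P (upTo (B + d)) ++ []                          ≡⟨ ++-identityʳ _ ⟩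
    filterᵇ P (upTo (B + d))                                ≡⟨ extend d ⟩
    filterᵇ P (upTo B)                                      ∎
    where
    open ≡-Reasoning
    rejected : ¬ T (P (B + d))
    rejected = subst T (beyond (m≤m+n B d))

ord-rep : ∀ {n k p} → Prime p → 1 ≤ n → 1 ≤ k → ord p (rep n k) ≡ ord p n + ord p (ρ k (len n))
ord-rep {n} {k} pr 1≤n 1≤k = ord-* pr 1≤n (1≤ρ (len n) 1≤k)

ord-rev-rep : ∀ {n k p} → Prime p → 1 ≤ n → ¬ 10 ∣ n → 1 ≤ k →
  ord p (rev (rep n k)) ≡ ord p (rev n) + ord p (ρ k (len n))
ord-rev-rep {n} {k} {p} pr 1≤n 10∤n 1≤k =
  trans (cong (ord p) (rev-rep n k)) (ord-* pr (1≤rev 1≤n 10∤n) (1≤ρ (len n) 1≤k))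

crucialTest-rep : ∀ {n k} x → 1 ≤ n → ¬ 10 ∣ n → 1 ≤ k → crucialTest (rep n k) x ≡ crucialTest n x
crucialTest-rep {n} {k} x 1≤n 10∤n 1≤k with prime? x
... | no  _  = refl
... | yes pr = cong not (begin
  (ord x (rep n k) ≡ᵇ ord x (rev (rep n k)))  ≡⟨ cong₂ _≡ᵇ_ (ord-rep pr 1≤n 1≤k) (ord-rev-rep pr 1≤n 10∤n 1≤k) ⟩
  (ord x n + t ≡ᵇ ord x (rev n) + t)          ≡⟨ ≡ᵇ-+ʳ (ord x n) (ord x (rev n)) t ⟩
  (ord x n ≡ᵇ ord x (rev n))                  ∎)
  where
  open ≡-Reasoning
  t = ord x (ρ k (len n))

crucialTest-beyond : ∀ {N x} → 1 ≤ N → 1 ≤ rev N → suc (N * rev N) ≤ x → crucialTest N x ≡ false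
crucialTest-beyond {N} {x} 1≤N 1≤r N*r<x = begin
  isPrimeᵇ x ∧ not (ord x N ≡ᵇ ord x (rev N))
    ≡⟨ cong₂ (λ a b → isPrimeᵇ x ∧ not (a ≡ᵇ b)) (ord-small 1≤N N≤N*r) (ord-small 1≤r r≤N*r) ⟩
  isPrimeᵇ x ∧ false                            ≡⟨ ∧-zeroʳ (isPrimeᵇ x) ⟩
  false                                         ∎
  where
  open ≡-Reasoning
  N≤N*r : N ≤ N * rev N
  N≤N*r = m≤m*n N (rev N) {{>-nonZero 1≤r}}
  r≤N*r : rev N ≤ N * rev N
  r≤N*r = m≤n*m (rev N) N {{>-nonZero 1≤N}}
  ord-small : ∀ {y} → 1 ≤ y → y ≤ N * rev N → ord x y ≡ 0
  ord-small {y} 1≤y y≤N*r = ∤⇒ord≡0 x λ x∣y →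
    <⇒≱ (≤-trans (s≤s y≤N*r) N*r<x) (∣⇒≤ {{>-nonZero 1≤y}} x∣y)

crucial-rep : ∀ {n k} → 1 ≤ n → ¬ 10 ∣ n → 1 ≤ k → crucial (rep n k) ≡ crucial n
crucial-rep {n} {k} 1≤n 10∤n 1≤k = begin
  filterᵇ (crucialTest (rep n k)) (upTo (suc (rep n k * rev (rep n k))))
    ≡⟨ filter-≐ (T? ∘ crucialTest (rep n k)) (T? ∘ crucialTest n) same-test (upTo (suc (rep n k * rev (rep n k)))) ⟩
  filterᵇ (crucialTest n) (upTo (suc (rep n k * rev (rep n k))))
    ≡⟨ filterᵇ-upTo-extend (crucialTest n) (s≤s bound≤) (crucialTest-beyond 1≤n 1≤r) ⟩
  filterᵇ (crucialTest n) (upTo (suc (n * rev n)))  ∎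
  where
  open ≡-Reasoning
  1≤r : 1 ≤ rev n
  1≤r = 1≤rev 1≤n 10∤n
  same-test : (T ∘ crucialTest (rep n k)) ≐ (T ∘ crucialTest n)
  same-test = (λ {x} → subst T (crucialTest-rep x 1≤n 10∤n 1≤k))
            , (λ {x} → subst T (sym (crucialTest-rep x 1≤n 10∤n 1≤k)))
  instance _ = >-nonZero (1≤ρ (len n) 1≤k)
  bound≤ : n * rev n ≤ rep n k * rev (rep n k)
  bound≤ = *-mono-≤ (m≤m*n n (ρ k (len n)))
                    (subst (rev n ≤_) (sym (rev-rep n k)) (m≤m*n (rev n) (ρ k (len n))))

typeAt-rep : ∀ {n k j p} → Prime p → 1 ≤ n → ¬ 10 ∣ n → 1 ≤ k → 1 ≤ j →
  typeAt (rep n k) j p ≡ typeAt n (k * j) p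
typeAt-rep {n} {k} {j} {p} pr 1≤n 10∤n 1≤k 1≤j = cong₂ (φ p) δ-same μ-shift
  where
  open ≡-Reasoning
  L = len n
  a = ord p n
  b = ord p (rev n)
  t = ord p (ρ k L)
  A = ord p (rep n k)
  B = ord p (rev (rep n k))
  s = ord p (ρ j (len (rep n k)))
  A≡a+t : A ≡ a + t
  A≡a+t = ord-rep pr 1≤n 1≤k
  B≡b+t : B ≡ b + t
  B≡b+t = ord-rev-rep pr 1≤n 10∤n 1≤k
  δ-same : absδ A B ≡ absδ a b
  δ-same = trans (cong₂ absδ A≡a+t B≡b+t) (absδ-+ʳ a b t)
  ord-ρ-kj : ord p (ρ (k * j) L) ≡ t + s
  ord-ρ-kj = begin
    ord p (ρ (k * j) L)                   ≡⟨ cong (ord p) (ρ-* k j L) ⟩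
    ord p (ρ k L * ρ j (k * L))           ≡⟨ ord-* pr (1≤ρ L 1≤k) (1≤ρ (k * L) 1≤j) ⟩
    t + ord p (ρ j (k * L))               ≡⟨ cong (λ l → t + ord p (ρ j l)) (len-rep n k) ⟨
    t + s                                 ∎
  μ-shift : A ∸ (A ∸ B) + s ≡ a ∸ (a ∸ b) + ord p (ρ (k * j) L)
  μ-shift = begin
    A ∸ (A ∸ B) + s                       ≡⟨ cong₂ (λ A B → A ∸ (A ∸ B) + s) A≡a+t B≡b+t ⟩
    (a + t) ∸ ((a + t) ∸ (b + t)) + s     ≡⟨ cong (_+ s) (min-+ʳ a b t) ⟩
    a ∸ (a ∸ b) + t + s                   ≡⟨ +-assoc (a ∸ (a ∸ b)) t s ⟩
    a ∸ (a ∸ b) + (t + s)                 ≡⟨ cong (a ∸ (a ∸ b) +_) ord-ρ-kj ⟨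
    a ∸ (a ∸ b) + ord p (ρ (k * j) L)     ∎

mainTheorem2 : (n k j : ℕ) → 1 ≤ n → ¬ (10 ∣ n) → n ≢ rev n → 1 ≤ k → 1 ≤ j →
    VPal (rep n (k * j)) →
    (u w : List ℕ) → IsType n (k * j) u → IsType (rep n k) j w → u ≡ w
mainTheorem2 n k j 1≤n 10∤n _ 1≤k 1≤j _ u w u-type w-type = begin
  u                                            ≡⟨ IsType⇒≡typeAt 1≤L (*-mono-≤ 1≤k 1≤j) u-type ⟩
  map (typeAt n (k * j)) (crucial n)           ≡⟨ map-cong-local (All.map typeAt-rep′ (crucial-prime n)) ⟩
  map (typeAt (rep n k) j) (crucial n)         ≡⟨ cong (map (typeAt (rep n k) j)) (crucial-rep 1≤n 10∤n 1≤k) ⟨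
  map (typeAt (rep n k) j) (crucial (rep n k)) ≡⟨ IsType⇒≡typeAt 1≤L′ 1≤j w-type ⟨
  w                                            ∎
  where
  open ≡-Reasoning
  1≤L : 1 ≤ len n
  1≤L = 1≤len 1≤n
  typeAt-rep′ : ∀ {p} → Prime p → typeAt n (k * j) p ≡ typeAt (rep n k) j p
  typeAt-rep′ pr = sym (typeAt-rep pr 1≤n 10∤n 1≤k 1≤j)
  1≤L′ : 1 ≤ len (rep n k)
  1≤L′ = subst (1 ≤_) (sym (len-rep n k)) (*-mono-≤ 1≤k 1≤L)
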